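{- For any modal formula $A$, the following are equivalent: (1) $\mathbf{NR4}\vdash A$; (2) $A$ is valid in all transitive and serial $\mathbf{N}$-frames; (3) $A$ is valid in all finite transitive and serial $\mathbf{N}$-frames; (4) $A$ is valid in all finite $\mathrm{Sub}(A)$-transitive and $\mathrm{Sub}(A)$-serial $\mathbf{N}$-frames.
   Context: Modal formulas are built from propositional variables and $\bot$ using $\neg,\land,\lor,\to$ and $\Box$; $\mathrm{Sub}(A)$ is the set of subformulas of $A$. $\mathbf{N}$ has all propositional tautologies as axioms and Modus Ponens and Necessitation $A/\Box A$ as rules; $\mathbf{NR}$ is $\mathbf{N}$ plus the rule $\neg B/\neg\Box B$; $\mathbf{NR4}$ is $\mathbf{NR}$ plus the axiom scheme $\Box B\to\Box\Box B$. An $\mathbf{N}$-frame is $(W, \{\prec_B\}_B)$ with $W$ nonempty and a binary relation $\prec_B$ on $W$ for each modal formula $B$ (finite if $W$ is finite); an $\mathbf{N}$-model adds $\Vdash$ with usual propositional clauses and $x\Vdash\Box B$ iff $y\Vdash B$ for all $y$ with $x\prec_B y$. Validity in a frame means truth at all worlds of all models on the frame. The frame is $B$-serial if every $x$ has some $y$ with $x\prec_B y$; $\Gamma$-serial if $B$-serial for every $B$ with $\Box B\in\Gamma$; serial if $B$-serial for all $B$. It is $B$-transitive if $x\prec_{\Box B} y$ and $y\prec_B z$ imply $x\prec_B z$; $\Gamma$-transitive if $B$-transitive for every $B$ with $\Box\Box B\in\Gamma$; transitive if $B$-transitive for all $B$. -}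

module Defs where

open import Data.Nat using (ℕ)
open import Data.Bool using (Bool; true; false; not; _∧_; _∨_)
open import Data.Fin using (Fin)
open import Data.Product using (Σ; ∃; _×_; _,_)
open import Relation.Binary.PropositionalEquality using (_≡_)
open import Function.Bundles using (_↔_)

infixr 6 _∧'_
infixr 5 _∨'_
infixr 4 _⇒_

data Fm : Set where
  var  : ℕ → Fm
  ⊥'   : Fm
  ¬'_  : Fm → Fm
  _∧'_ : Fm → Fm → Fm
  _∨'_ : Fm → Fm → Fm
  _⇒_  : Fm → Fm → Fm
  □_   : Fm → Fm

data _∈Sub_ : Fm → Fm → Set where
  here  : ∀ {A} → A ∈Sub A
  in¬   : ∀ {B A} → B ∈Sub A → B ∈Sub (¬' A)
  in∧ˡ  : ∀ {B A C} → B ∈Sub A → B ∈Sub (A ∧' C)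
  in∧ʳ  : ∀ {B A C} → B ∈Sub C → B ∈Sub (A ∧' C)
  in∨ˡ  : ∀ {B A C} → B ∈Sub A → B ∈Sub (A ∨' C)
  in∨ʳ  : ∀ {B A C} → B ∈Sub C → B ∈Sub (A ∨' C)
  in⇒ˡ  : ∀ {B A C} → B ∈Sub A → B ∈Sub (A ⇒ C)
  in⇒ʳ  : ∀ {B A C} → B ∈Sub C → B ∈Sub (A ⇒ C)
  in□   : ∀ {B A} → B ∈Sub A → B ∈Sub (□ A)

evalP : (Fm → Bool) → Fm → Bool
evalP v (var n)  = v (var n)
evalP v ⊥'       = false
evalP v (¬' A)   = not (evalP v A)
evalP v (A ∧' B) = evalP v A ∧ evalP v B
evalP v (A ∨' B) = evalP v A ∨ evalP v B
evalP v (A ⇒ B)  = not (evalP v A) ∨ evalP v B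
evalP v (□ A)    = v (□ A)

Tautology : Fm → Set
Tautology A = (v : Fm → Bool) → evalP v A ≡ true

data NR4⊢_ : Fm → Set where
  taut : ∀ {A} → Tautology A → NR4⊢ A
  mp   : ∀ {A B} → NR4⊢ (A ⇒ B) → NR4⊢ A → NR4⊢ B
  nec  : ∀ {A} → NR4⊢ A → NR4⊢ (□ A)
  ruleR : ∀ {B} → NR4⊢ (¬' B) → NR4⊢ (¬' (□ B))
  ax4  : ∀ {B} → NR4⊢ (□ B ⇒ □ (□ B))

record NFrame : Set₁ where
  field
    W      : Set
    inhab  : W
    _≺[_]_ : W → Fm → W → Set

open NFrame public

record NModel (F : NFrame) : Set₁ where
  field
    _⊩_    : W F → Fm → Bool
    ⊩⊥     : ∀ x → x ⊩ ⊥' ≡ false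
    ⊩¬     : ∀ x A → x ⊩ (¬' A) ≡ not (x ⊩ A)
    ⊩∧     : ∀ x A B → x ⊩ (A ∧' B) ≡ (x ⊩ A) ∧ (x ⊩ B)
    ⊩∨     : ∀ x A B → x ⊩ (A ∨' B) ≡ (x ⊩ A) ∨ (x ⊩ B)
    ⊩⇒     : ∀ x A B → x ⊩ (A ⇒ B) ≡ not (x ⊩ A) ∨ (x ⊩ B)
    ⊩□→    : ∀ x B → x ⊩ (□ B) ≡ true →
               ∀ y → _≺[_]_ F x B y → y ⊩ B ≡ true
    ⊩□←    : ∀ x B → (∀ y → _≺[_]_ F x B y → y ⊩ B ≡ true) →
               x ⊩ (□ B) ≡ true

ValidIn : Fm → NFrame → Set₁
ValidIn A F = (M : NModel F) → (x : W F) → NModel._⊩_ M x A ≡ true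

Finite : NFrame → Set
Finite F = Σ ℕ (λ n → Fin n ↔ W F)

SerialAt : NFrame → Fm → Set
SerialAt F B = (x : W F) → Σ (W F) (λ y → _≺[_]_ F x B y)

TransitiveAt : NFrame → Fm → Set
TransitiveAt F B = (x y z : W F) →
  _≺[_]_ F x (□ B) y → _≺[_]_ F y B z → _≺[_]_ F x B z

Serial : NFrame → Set
Serial F = (B : Fm) → SerialAt F B

Transitive : NFrame → Set
Transitive F = (B : Fm) → TransitiveAt F B

SubSerial : Fm → NFrame → Set
SubSerial A F = (B : Fm) → (□ B) ∈Sub A → SerialAt F B

SubTransitive : Fm → NFrame → Set
SubTransitive A F = (B : Fm) → (□ (□ B)) ∈Sub A → TransitiveAt F B

Cond2 Cond3 Cond4 : Fm → Set₁
Cond2 A = (F : NFrame) → Transitive F → Serial F → ValidIn A F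
Cond3 A = (F : NFrame) → Finite F → Transitive F → Serial F → ValidIn A F
Cond4 A = (F : NFrame) → Finite F → SubTransitive A F → SubSerial A F → ValidIn A F

-- Working inside out, replace every □C by ⊤ if the reduct s of C is a
-- tautology, by ⊥ if s is unsatisfiable, and otherwise keep it as a propositional atom,
-- except that a contingent □□E becomes s ∨ □□E.  Necessitation, rule R and axiom 4 make
-- every formula NR4-equivalent to its reduct, and on a Sub(A)-transitive, Sub(A)-serial
-- frame every subformula of A is forced exactly where its reduct is true.  Conversely,
-- if a valuation v₀ refutes the reduct of A, take as worlds v₀ together with a falsifying
-- and a satisfying valuation of the reduct of each contingent boxed subformula C, and
-- let x ≺_C y mean that y forces C whenever □C is true at x.  This finite frame is
-- transitive and serial and refutes A.  So each of the four conditions is equivalent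
-- to the reduct of A being a tautology.

module Submission where

open import Defs
open import Data.Bool using (Bool; true; false; not; _∧_; _∨_)
open import Data.Bool.Properties using (not-injective)
open import Data.Fin using (Fin; zero)
open import Data.List using (List; []; _∷_; _++_; concatMap; length; lookup)
open import Data.List.Membership.Propositional using (_∈_; _∉_; lose)
open import Data.List.Membership.Propositional.Properties using (∈-++⁺ˡ; ∈-++⁺ʳ; ∈-++⁻; ∈-concatMap⁺)
open import Data.List.Relation.Unary.All using (All; []; _∷_; tabulate)
open import Data.List.Relation.Unary.All.Properties using (++⁻ˡ; ++⁻ʳ)
open import Data.List.Relation.Unary.Any using (here; there; index)
open import Data.List.Relation.Unary.Any.Properties using (lookup-index)
open import Data.Nat.Properties using () renaming (_≟_ to _≟ℕ_)
open import Data.Product using (∃; _×_; _,_)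
open import Data.Sum using (_⊎_; inj₁; inj₂)
open import Function using (_∘_)
open import Function.Bundles using (_⇔_; mk⇔)
open import Function.Properties.Inverse using (↔-refl)
open import Relation.Binary.Definitions using (DecidableEquality)
open import Relation.Binary.PropositionalEquality using (_≡_; refl; sym; trans; cong; cong₂)
open import Relation.Nullary using (¬_; yes; no; contradiction)
open import Relation.Nullary.Decidable using (map′; _×-dec_)

var-injective : ∀ {m n} → var m ≡ var n → m ≡ n
var-injective refl = refl

¬'-injective : ∀ {A B} → ¬' A ≡ ¬' B → A ≡ B
¬'-injective refl = refl

∧'-injective : ∀ {A B C D} → A ∧' B ≡ C ∧' D → A ≡ C × B ≡ D
∧'-injective refl = refl , refl

∨'-injective : ∀ {A B C D} → A ∨' B ≡ C ∨' D → A ≡ C × B ≡ D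
∨'-injective refl = refl , refl

⇒-injective : ∀ {A B C D} → (A ⇒ B) ≡ (C ⇒ D) → A ≡ C × B ≡ D
⇒-injective refl = refl , refl

□-injective : ∀ {A B} → □ A ≡ □ B → A ≡ B
□-injective refl = refl

infix 4 _≟_
_≟_ : DecidableEquality Fm
var m    ≟ var n    = map′ (cong var) var-injective (m ≟ℕ n)
var _    ≟ ⊥'       = no λ ()
var _    ≟ ¬' _     = no λ ()
var _    ≟ _ ∧' _   = no λ ()
var _    ≟ _ ∨' _   = no λ ()
var _    ≟ (_ ⇒ _)  = no λ ()
var _    ≟ □ _      = no λ ()
⊥'       ≟ var _    = no λ ()
⊥'       ≟ ⊥'       = yes refl
⊥'       ≟ ¬' _     = no λ ()
⊥'       ≟ _ ∧' _   = no λ ()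
⊥'       ≟ _ ∨' _   = no λ ()
⊥'       ≟ (_ ⇒ _)  = no λ ()
⊥'       ≟ □ _      = no λ ()
¬' _     ≟ var _    = no λ ()
¬' _     ≟ ⊥'       = no λ ()
¬' A     ≟ ¬' B     = map′ (cong ¬'_) ¬'-injective (A ≟ B)
¬' _     ≟ _ ∧' _   = no λ ()
¬' _     ≟ _ ∨' _   = no λ ()
¬' _     ≟ (_ ⇒ _)  = no λ ()
¬' _     ≟ □ _      = no λ ()
_ ∧' _   ≟ var _    = no λ ()
_ ∧' _   ≟ ⊥'       = no λ ()
_ ∧' _   ≟ ¬' _     = no λ ()
A ∧' B   ≟ C ∧' D   = map′ (λ (p , q) → cong₂ _∧'_ p q) ∧'-injective (A ≟ C ×-dec B ≟ D)
_ ∧' _   ≟ _ ∨' _   = no λ ()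
_ ∧' _   ≟ (_ ⇒ _)  = no λ ()
_ ∧' _   ≟ □ _      = no λ ()
_ ∨' _   ≟ var _    = no λ ()
_ ∨' _   ≟ ⊥'       = no λ ()
_ ∨' _   ≟ ¬' _     = no λ ()
_ ∨' _   ≟ _ ∧' _   = no λ ()
A ∨' B   ≟ C ∨' D   = map′ (λ (p , q) → cong₂ _∨'_ p q) ∨'-injective (A ≟ C ×-dec B ≟ D)
_ ∨' _   ≟ (_ ⇒ _)  = no λ ()
_ ∨' _   ≟ □ _      = no λ ()
(_ ⇒ _)  ≟ var _    = no λ ()
(_ ⇒ _)  ≟ ⊥'       = no λ ()
(_ ⇒ _)  ≟ ¬' _     = no λ ()
(_ ⇒ _)  ≟ _ ∧' _   = no λ ()
(_ ⇒ _)  ≟ _ ∨' _   = no λ ()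
(A ⇒ B)  ≟ (C ⇒ D)  = map′ (λ (p , q) → cong₂ _⇒_ p q) ⇒-injective (A ≟ C ×-dec B ≟ D)
(_ ⇒ _)  ≟ □ _      = no λ ()
□ _      ≟ var _    = no λ ()
□ _      ≟ ⊥'       = no λ ()
□ _      ≟ ¬' _     = no λ ()
□ _      ≟ _ ∧' _   = no λ ()
□ _      ≟ _ ∨' _   = no λ ()
□ _      ≟ (_ ⇒ _)  = no λ ()
□ A      ≟ □ B      = map′ (cong □_) □-injective (A ≟ B)

open import Data.List.Membership.DecPropositional _≟_ using (_∈?_)

⇒ᵇ-intro : ∀ {a b} → (a ≡ true → b ≡ true) → not a ∨ b ≡ true
⇒ᵇ-intro {true}  a⇒b = a⇒b refl
⇒ᵇ-intro {false} _   = refl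

⇒ᵇ-elim : ∀ {a b} → not a ∨ b ≡ true → a ≡ true → b ≡ true
⇒ᵇ-elim a⇒b refl = a⇒b

∨-absorbs-weaker : ∀ {a b} → (a ≡ true → b ≡ true) → a ∨ b ≡ b
∨-absorbs-weaker {true}  a⇒b = sym (a⇒b refl)
∨-absorbs-weaker {false} _   = refl

Valuation : Set
Valuation = Fm → Bool

atoms : Fm → List Fm
atoms (var n)  = var n ∷ []
atoms ⊥'       = []
atoms (¬' A)   = atoms A
atoms (A ∧' B) = atoms A ++ atoms B
atoms (A ∨' B) = atoms A ++ atoms B
atoms (A ⇒ B)  = atoms A ++ atoms B
atoms (□ A)    = □ A ∷ []

evalP-cong : ∀ A {v w : Valuation} → All (λ a → v a ≡ w a) (atoms A) → evalP v A ≡ evalP w A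
evalP-cong (var n)  (v≈w ∷ []) = v≈w
evalP-cong ⊥'       []         = refl
evalP-cong (¬' A)   v≈w        = cong not (evalP-cong A v≈w)
evalP-cong (A ∧' B) v≈w        =
  cong₂ _∧_ (evalP-cong A (++⁻ˡ (atoms A) v≈w)) (evalP-cong B (++⁻ʳ (atoms A) v≈w))
evalP-cong (A ∨' B) v≈w        =
  cong₂ _∨_ (evalP-cong A (++⁻ˡ (atoms A) v≈w)) (evalP-cong B (++⁻ʳ (atoms A) v≈w))
evalP-cong (A ⇒ B)  v≈w        =
  cong₂ (λ a b → not a ∨ b) (evalP-cong A (++⁻ˡ (atoms A) v≈w)) (evalP-cong B (++⁻ʳ (atoms A) v≈w))
evalP-cong (□ A)    (v≈w ∷ []) = v≈w

data Verdict (A : Fm) : Set where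
  tautology : Tautology A → Verdict A
  refuted   : (v : Valuation) → evalP v A ≡ false → Verdict A

_[_≔_] : Valuation → Fm → Bool → Valuation
(v [ a ≔ b ]) x with x ≟ a
... | yes _ = b
... | no  _ = v x

module TruthTable (A : Fm) where

  ValidAround : List Fm → Valuation → Set
  ValidAround as v = ∀ w → (∀ x → x ∉ as → w x ≡ v x) → evalP w A ≡ true

  agrees-after-update : ∀ {a as} (v w : Valuation) → (∀ x → x ∉ a ∷ as → w x ≡ v x) →
                        ∀ x → x ∉ as → w x ≡ (v [ a ≔ w a ]) x
  agrees-after-update {a} v w w≈v x x∉as with x ≟ a
  ... | yes refl = refl
  ... | no  x≢a  = w≈v x λ { (here x≡a) → x≢a x≡a ; (there x∈as) → x∉as x∈as }

  search : ∀ as v → ValidAround as v ⊎ ∃ λ w → evalP w A ≡ false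
  search [] v with evalP v A in v⊨A
  ... | true  = inj₁ λ w w≈v → trans (evalP-cong A (tabulate λ _ → w≈v _ λ ())) v⊨A
  ... | false = inj₂ (v , v⊨A)
  search (a ∷ as) v with search as (v [ a ≔ true ]) | search as (v [ a ≔ false ])
  ... | inj₂ r | _      = inj₂ r
  ... | inj₁ _ | inj₂ r = inj₂ r
  ... | inj₁ t | inj₁ f = inj₁ λ w w≈v → both (w a) w (agrees-after-update v w w≈v)
    where
    both : ∀ b → ValidAround as (v [ a ≔ b ])
    both true  = t
    both false = f

  restrict : Valuation → Valuation
  restrict w x with x ∈? atoms A
  ... | yes _ = w x
  ... | no  _ = false

  restrict-on-atoms : ∀ w {x} → x ∈ atoms A → w x ≡ restrict w x
  restrict-on-atoms w {x} x∈A with x ∈? atoms A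
  ... | yes _   = refl
  ... | no  x∉A = contradiction x∈A x∉A

  restrict-off-atoms : ∀ w x → x ∉ atoms A → restrict w x ≡ false
  restrict-off-atoms w x x∉A with x ∈? atoms A
  ... | yes x∈A = contradiction x∈A x∉A
  ... | no  _   = refl

  verdict : Verdict A
  verdict with search (atoms A) (λ _ → false)
  ... | inj₂ (w , w⊭A)    = refuted w w⊭A
  ... | inj₁ valid-around = tautology λ w →
    trans (evalP-cong A (tabulate (restrict-on-atoms w))) (valid-around (restrict w) (restrict-off-atoms w))

open TruthTable using (verdict)

-- The reduct of a formula

data Status (s : Fm) : Set where
  valid         : Tautology s → Status s
  unsatisfiable : (∀ v → evalP v s ≡ false) → Status s
  contingent    : (v : Valuation) → evalP v s ≡ false →
                  (w : Valuation) → evalP w s ≡ true → Status s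

status : (s : Fm) → Status s
status s with verdict s | verdict (¬' s)
... | tautology s-valid | _                    = valid s-valid
... | refuted _ _         | tautology ¬s-valid   = unsatisfiable λ w → not-injective (¬s-valid w)
... | refuted v v⊭s     | refuted w w⊭¬s       = contingent v v⊭s w (not-injective w⊭¬s)

data BoxView : Fm → Set where
  nested : ∀ E → BoxView (□ E)
  plain  : ∀ C → BoxView C

boxView : ∀ C → BoxView C
boxView (□ E) = nested E
boxView C     = plain C

⊤' : Fm
⊤' = ¬' ⊥'

reduceBox : ∀ {C} → BoxView C → (s : Fm) → Status s → Fm
reduceBox _          s (valid _)            = ⊤'
reduceBox _          s (unsatisfiable _)    = ⊥'
-- The disjunct s builds axiom 4 into the reduct; it makes the countermodel transitive.
reduceBox (nested E) s (contingent _ _ _ _) = s ∨' □ □ E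
reduceBox (plain C)  s (contingent _ _ _ _) = □ C

reduce : Fm → Fm
reduce (var n)  = var n
reduce ⊥'       = ⊥'
reduce (¬' A)   = ¬' reduce A
reduce (A ∧' B) = reduce A ∧' reduce B
reduce (A ∨' B) = reduce A ∨' reduce B
reduce (A ⇒ B)  = reduce A ⇒ reduce B
reduce (□ C)    = reduceBox (boxView C) (reduce C) (status (reduce C))

infix 3 _⇔'_
_⇔'_ : Fm → Fm → Fm
P ⇔' Q = (P ⇒ Q) ∧' (Q ⇒ P)

evalP-⇔'⁺ : ∀ v P Q → evalP v P ≡ evalP v Q → evalP v (P ⇔' Q) ≡ true
evalP-⇔'⁺ v P Q P≡Q with evalP v P | evalP v Q
evalP-⇔'⁺ _ P Q refl | true  | true  = refl
evalP-⇔'⁺ _ P Q refl | false | false = refl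

evalP-⇔'⁻ : ∀ {v} P Q → evalP v (P ⇔' Q) ≡ true → evalP v P ≡ evalP v Q
evalP-⇔'⁻ {v} P Q P⇔Q with evalP v P | evalP v Q
evalP-⇔'⁻ P Q _  | true  | true  = refl
evalP-⇔'⁻ P Q () | true  | false
evalP-⇔'⁻ P Q () | false | true
evalP-⇔'⁻ P Q _  | false | false = refl

tautological-consequence : ∀ {Ps Q} → All NR4⊢_ Ps →
                           (∀ v → All (λ P → evalP v P ≡ true) Ps → evalP v Q ≡ true) → NR4⊢ Q
tautological-consequence []         entails = taut λ v → entails v []
tautological-consequence (⊢P ∷ ⊢Ps) entails =
  mp (tautological-consequence ⊢Ps λ v Ps-hold → ⇒ᵇ-intro λ P-holds → entails v (P-holds ∷ Ps-hold)) ⊢P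

⇔'-by : ∀ {Ps X Y} → All NR4⊢_ Ps →
        (∀ v → All (λ P → evalP v P ≡ true) Ps → evalP v X ≡ evalP v Y) → NR4⊢ (X ⇔' Y)
⇔'-by {X = X} {Y} ⊢Ps same = tautological-consequence ⊢Ps λ v Ps-hold → evalP-⇔'⁺ v X Y (same v Ps-hold)

⇔'-mp : ∀ {P Q} → NR4⊢ (P ⇔' Q) → NR4⊢ P → NR4⊢ Q
⇔'-mp {P} {Q} ⊢P⇔Q ⊢P = tautological-consequence (⊢P⇔Q ∷ ⊢P ∷ []) λ { _ (P⇔Q ∷ P-holds ∷ []) →
  trans (sym (evalP-⇔'⁻ P Q P⇔Q)) P-holds }

⇔'-refl : ∀ {P} → NR4⊢ (P ⇔' P)
⇔'-refl = ⇔'-by [] λ { _ [] → refl }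

¬'-cong : ∀ {P Q} → NR4⊢ (P ⇔' Q) → NR4⊢ (¬' P ⇔' ¬' Q)
¬'-cong {P} {Q} ⊢P⇔Q = ⇔'-by (⊢P⇔Q ∷ []) λ { _ (P⇔Q ∷ []) → cong not (evalP-⇔'⁻ P Q P⇔Q) }

∧'-cong : ∀ {P Q R S} → NR4⊢ (P ⇔' Q) → NR4⊢ (R ⇔' S) → NR4⊢ (P ∧' R ⇔' Q ∧' S)
∧'-cong {P} {Q} {R} {S} ⊢P⇔Q ⊢R⇔S = ⇔'-by (⊢P⇔Q ∷ ⊢R⇔S ∷ []) λ { _ (P⇔Q ∷ R⇔S ∷ []) →
  cong₂ _∧_ (evalP-⇔'⁻ P Q P⇔Q) (evalP-⇔'⁻ R S R⇔S) }

∨'-cong : ∀ {P Q R S} → NR4⊢ (P ⇔' Q) → NR4⊢ (R ⇔' S) → NR4⊢ (P ∨' R ⇔' Q ∨' S)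
∨'-cong {P} {Q} {R} {S} ⊢P⇔Q ⊢R⇔S = ⇔'-by (⊢P⇔Q ∷ ⊢R⇔S ∷ []) λ { _ (P⇔Q ∷ R⇔S ∷ []) →
  cong₂ _∨_ (evalP-⇔'⁻ P Q P⇔Q) (evalP-⇔'⁻ R S R⇔S) }

⇒-cong : ∀ {P Q R S} → NR4⊢ (P ⇔' Q) → NR4⊢ (R ⇔' S) → NR4⊢ ((P ⇒ R) ⇔' (Q ⇒ S))
⇒-cong {P} {Q} {R} {S} ⊢P⇔Q ⊢R⇔S = ⇔'-by (⊢P⇔Q ∷ ⊢R⇔S ∷ []) λ { _ (P⇔Q ∷ R⇔S ∷ []) →
  cong₂ (λ a b → not a ∨ b) (evalP-⇔'⁻ P Q P⇔Q) (evalP-⇔'⁻ R S R⇔S) }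

reduceBox-⇔' : ∀ {C s} (view : BoxView C) (st : Status s) → NR4⊢ (s ⇔' C) →
               NR4⊢ (reduceBox view s st ⇔' □ C)
reduceBox-⇔' _ (valid s-valid) ⊢s⇔C =
  ⇔'-by (nec (⇔'-mp ⊢s⇔C (taut s-valid)) ∷ []) λ { _ (□C-holds ∷ []) → sym □C-holds }
reduceBox-⇔' _ (unsatisfiable s-unsat) ⊢s⇔C =
  ⇔'-by (ruleR (⇔'-mp (¬'-cong ⊢s⇔C) (taut (cong not ∘ s-unsat))) ∷ []) λ { _ (¬□C-holds ∷ []) →
    sym (not-injective ¬□C-holds) }
reduceBox-⇔' {s = s} (nested E) (contingent _ _ _ _) ⊢s⇔□E =
  ⇔'-by (⊢s⇔□E ∷ ax4 ∷ []) λ { _ (s⇔□E ∷ four ∷ []) →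
    ∨-absorbs-weaker λ s-holds → ⇒ᵇ-elim four (trans (sym (evalP-⇔'⁻ s (□ E) s⇔□E)) s-holds) }
reduceBox-⇔' (plain C) (contingent _ _ _ _) _ = ⇔'-refl

reduce-⇔' : ∀ A → NR4⊢ (reduce A ⇔' A)
reduce-⇔' (var n)  = ⇔'-refl
reduce-⇔' ⊥'       = ⇔'-refl
reduce-⇔' (¬' A)   = ¬'-cong (reduce-⇔' A)
reduce-⇔' (A ∧' B) = ∧'-cong (reduce-⇔' A) (reduce-⇔' B)
reduce-⇔' (A ∨' B) = ∨'-cong (reduce-⇔' A) (reduce-⇔' B)
reduce-⇔' (A ⇒ B)  = ⇒-cong (reduce-⇔' A) (reduce-⇔' B)
reduce-⇔' (□ C)    = reduceBox-⇔' (boxView C) (status (reduce C)) (reduce-⇔' C)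

⊢-from-reduce : ∀ A → Tautology (reduce A) → NR4⊢ A
⊢-from-reduce A reduce-A-valid = ⇔'-mp (reduce-⇔' A) (taut reduce-A-valid)

evalP-reduceBox-nested : ∀ {v s E} (st : Status s) → evalP v s ≡ true →
                         evalP v (reduceBox (nested E) s st) ≡ true
evalP-reduceBox-nested (valid _)                   _   = refl
evalP-reduceBox-nested {v} (unsatisfiable s-unsat) v⊨s = contradiction (trans (sym v⊨s) (s-unsat v)) λ ()
evalP-reduceBox-nested (contingent _ _ _ _)        v⊨s = cong (_∨ _) v⊨s

-- Soundness, and the reduct on Sub(A)-frames

module _ {F : NFrame} (M : NModel F) where
  open NModel M

  evalP-⊩ : ∀ x A → evalP (x ⊩_) A ≡ x ⊩ A
  evalP-⊩ x (var n)  = refl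
  evalP-⊩ x ⊥'       = sym (⊩⊥ x)
  evalP-⊩ x (¬' A)   = trans (cong not (evalP-⊩ x A)) (sym (⊩¬ x A))
  evalP-⊩ x (A ∧' B) = trans (cong₂ _∧_ (evalP-⊩ x A) (evalP-⊩ x B)) (sym (⊩∧ x A B))
  evalP-⊩ x (A ∨' B) = trans (cong₂ _∨_ (evalP-⊩ x A) (evalP-⊩ x B)) (sym (⊩∨ x A B))
  evalP-⊩ x (A ⇒ B)  =
    trans (cong₂ (λ a b → not a ∨ b) (evalP-⊩ x A) (evalP-⊩ x B)) (sym (⊩⇒ x A B))
  evalP-⊩ x (□ A)    = refl

  ⊩⇒-intro : ∀ x A B → (x ⊩ A ≡ true → x ⊩ B ≡ true) → x ⊩ (A ⇒ B) ≡ true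
  ⊩⇒-intro x A B A⇒B = trans (⊩⇒ x A B) (⇒ᵇ-intro A⇒B)

  ⊩⇒-elim : ∀ x A B → x ⊩ (A ⇒ B) ≡ true → x ⊩ A ≡ true → x ⊩ B ≡ true
  ⊩⇒-elim x A B x⊩A⇒B = ⇒ᵇ-elim (trans (sym (⊩⇒ x A B)) x⊩A⇒B)

  ⊩□-four : ∀ B → TransitiveAt F B → ∀ x → x ⊩ (□ B) ≡ true → x ⊩ (□ □ B) ≡ true
  ⊩□-four B trans-B x x⊩□B =
    ⊩□← x (□ B) λ y x≺y → ⊩□← y B λ z y≺z → ⊩□→ x B x⊩□B z (trans-B x y z x≺y y≺z)

  ⊩□-unsatisfiable : ∀ B → SerialAt F B → (∀ y → y ⊩ B ≡ false) → ∀ x → x ⊩ (□ B) ≡ false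
  ⊩□-unsatisfiable B serial-B B-false x with x ⊩ (□ B) in x⊩□B
  ... | false = refl
  ... | true  = let (y , x≺y) = serial-B x in
                contradiction (trans (sym (⊩□→ x B x⊩□B y x≺y)) (B-false y)) λ ()

  ⊢-sound : Transitive F → Serial F → ∀ {A} → NR4⊢ A → ∀ x → x ⊩ A ≡ true
  ⊢-sound _ _ (taut {A} A-valid) x = trans (sym (evalP-⊩ x A)) (A-valid _)
  ⊢-sound transitive serial (mp {A} {B} ⊢A⇒B ⊢A) x =
    ⊩⇒-elim x A B (⊢-sound transitive serial ⊢A⇒B x) (⊢-sound transitive serial ⊢A x)
  ⊢-sound transitive serial (nec ⊢A) x = ⊩□← x _ λ y _ → ⊢-sound transitive serial ⊢A y
  ⊢-sound transitive serial (ruleR {B} ⊢¬B) x =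
    trans (⊩¬ x (□ B)) (cong not (⊩□-unsatisfiable B (serial B) B-false x))
    where
    B-false : ∀ y → y ⊩ B ≡ false
    B-false y = not-injective (trans (sym (⊩¬ y B)) (⊢-sound transitive serial ⊢¬B y))
  ⊢-sound transitive _ (ax4 {B}) x = ⊩⇒-intro x (□ B) (□ □ B) (⊩□-four B (transitive B) x)

⊢⇒Cond2 : ∀ {A} → NR4⊢ A → Cond2 A
⊢⇒Cond2 ⊢A F transitive serial M = ⊢-sound M transitive serial ⊢A

∈Sub-trans : ∀ {B C A} → B ∈Sub C → C ∈Sub A → B ∈Sub A
∈Sub-trans B∈C here      = B∈C
∈Sub-trans B∈C (in¬ p)   = in¬ (∈Sub-trans B∈C p)
∈Sub-trans B∈C (in∧ˡ p)  = in∧ˡ (∈Sub-trans B∈C p)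
∈Sub-trans B∈C (in∧ʳ p)  = in∧ʳ (∈Sub-trans B∈C p)
∈Sub-trans B∈C (in∨ˡ p)  = in∨ˡ (∈Sub-trans B∈C p)
∈Sub-trans B∈C (in∨ʳ p)  = in∨ʳ (∈Sub-trans B∈C p)
∈Sub-trans B∈C (in⇒ˡ p)  = in⇒ˡ (∈Sub-trans B∈C p)
∈Sub-trans B∈C (in⇒ʳ p)  = in⇒ʳ (∈Sub-trans B∈C p)
∈Sub-trans B∈C (in□ p)   = in□ (∈Sub-trans B∈C p)

module _ (A : Fm) {F : NFrame} (transitive : SubTransitive A F) (serial : SubSerial A F)
         (M : NModel F) where
  open NModel M

  ⊩□-reduceBox : ∀ {C s} → (□ C) ∈Sub A → (view : BoxView C) (st : Status s) →
                 (∀ y → y ⊩ C ≡ evalP (y ⊩_) s) →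
                 ∀ x → x ⊩ (□ C) ≡ evalP (x ⊩_) (reduceBox view s st)
  ⊩□-reduceBox {C} _ _ (valid s-valid) C≡s x = ⊩□← x C λ y _ → trans (C≡s y) (s-valid _)
  ⊩□-reduceBox {C} □C∈A _ (unsatisfiable s-unsat) C≡s x =
    ⊩□-unsatisfiable M C (serial C □C∈A) (λ y → trans (C≡s y) (s-unsat _)) x
  ⊩□-reduceBox □□E∈A (nested E) (contingent _ _ _ _) □E≡s x =
    sym (trans (cong (_∨ x ⊩ (□ □ E)) (sym (□E≡s x)))
               (∨-absorbs-weaker (⊩□-four M E (transitive E □□E∈A) x)))
  ⊩□-reduceBox _ (plain C) (contingent _ _ _ _) _ x = refl

  ⊩-reduce : ∀ {D} → D ∈Sub A → ∀ x → x ⊩ D ≡ evalP (x ⊩_) (reduce D)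
  ⊩-reduce {var n}  _ x = refl
  ⊩-reduce {⊥'}     _ x = ⊩⊥ x
  ⊩-reduce {¬' D}   p x = trans (⊩¬ x D) (cong not (⊩-reduce (∈Sub-trans (in¬ here) p) x))
  ⊩-reduce {D ∧' E} p x = trans (⊩∧ x D E)
    (cong₂ _∧_ (⊩-reduce (∈Sub-trans (in∧ˡ here) p) x) (⊩-reduce (∈Sub-trans (in∧ʳ here) p) x))
  ⊩-reduce {D ∨' E} p x = trans (⊩∨ x D E)
    (cong₂ _∨_ (⊩-reduce (∈Sub-trans (in∨ˡ here) p) x) (⊩-reduce (∈Sub-trans (in∨ʳ here) p) x))
  ⊩-reduce {D ⇒ E}  p x = trans (⊩⇒ x D E) (cong₂ (λ a b → not a ∨ b)
    (⊩-reduce (∈Sub-trans (in⇒ˡ here) p) x) (⊩-reduce (∈Sub-trans (in⇒ʳ here) p) x))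
  ⊩-reduce {□ C}    p x =
    ⊩□-reduceBox p (boxView C) (status (reduce C)) (⊩-reduce (∈Sub-trans (in□ here) p)) x

reduce-valid⇒Cond4 : ∀ A → Tautology (reduce A) → Cond4 A
reduce-valid⇒Cond4 A reduce-A-valid F _ transitive serial M x =
  trans (⊩-reduce A transitive serial M here x) (reduce-A-valid _)

-- The finite countermodel

boxed : Fm → List Fm
boxed (var n)  = []
boxed ⊥'       = []
boxed (¬' A)   = boxed A
boxed (A ∧' B) = boxed A ++ boxed B
boxed (A ∨' B) = boxed A ++ boxed B
boxed (A ⇒ B)  = boxed A ++ boxed B
boxed (□ C)    = C ∷ boxed C

∈-boxed⁺ : ∀ {C A} → (□ C) ∈Sub A → C ∈ boxed A
∈-boxed⁺ here                    = here refl
∈-boxed⁺ (in¬ p)                 = ∈-boxed⁺ p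
∈-boxed⁺ (in∧ˡ p)                = ∈-++⁺ˡ (∈-boxed⁺ p)
∈-boxed⁺ (in∧ʳ {A = A} p)        = ∈-++⁺ʳ (boxed A) (∈-boxed⁺ p)
∈-boxed⁺ (in∨ˡ p)                = ∈-++⁺ˡ (∈-boxed⁺ p)
∈-boxed⁺ (in∨ʳ {A = A} p)        = ∈-++⁺ʳ (boxed A) (∈-boxed⁺ p)
∈-boxed⁺ (in⇒ˡ p)                = ∈-++⁺ˡ (∈-boxed⁺ p)
∈-boxed⁺ (in⇒ʳ {A = A} p)        = ∈-++⁺ʳ (boxed A) (∈-boxed⁺ p)
∈-boxed⁺ (in□ p)                 = there (∈-boxed⁺ p)

∈-boxed⁻ : ∀ A {C} → C ∈ boxed A → (□ C) ∈Sub A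
∈-boxed⁻ (¬' A)   C∈A = in¬ (∈-boxed⁻ A C∈A)
∈-boxed⁻ (A ∧' B) C∈A with ∈-++⁻ (boxed A) C∈A
... | inj₁ C∈A = in∧ˡ (∈-boxed⁻ A C∈A)
... | inj₂ C∈B = in∧ʳ (∈-boxed⁻ B C∈B)
∈-boxed⁻ (A ∨' B) C∈A with ∈-++⁻ (boxed A) C∈A
... | inj₁ C∈A = in∨ˡ (∈-boxed⁻ A C∈A)
... | inj₂ C∈B = in∨ʳ (∈-boxed⁻ B C∈B)
∈-boxed⁻ (A ⇒ B)  C∈A with ∈-++⁻ (boxed A) C∈A
... | inj₁ C∈A = in⇒ˡ (∈-boxed⁻ A C∈A)
... | inj₂ C∈B = in⇒ʳ (∈-boxed⁻ B C∈B)
∈-boxed⁻ (□ C)    (here refl)  = here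
∈-boxed⁻ (□ C)    (there C∈C)  = in□ (∈-boxed⁻ C C∈C)

witnesses : ∀ {s} → Status s → List Valuation
witnesses (contingent v _ w _) = v ∷ w ∷ []
witnesses _                    = []

module Countermodel (A : Fm) (v₀ : Valuation) where

  valuations : List Valuation
  valuations = v₀ ∷ concatMap (λ C → witnesses (status (reduce C))) (boxed A)

  World : Set
  World = Fin (length valuations)

  valuation : World → Valuation
  valuation = lookup valuations

  world-of : ∀ {v} → v ∈ valuations → ∃ λ x → valuation x ≡ v
  world-of v∈ = index v∈ , sym (lookup-index v∈)

  holds : World → Fm → Bool
  holds x D = evalP (valuation x) (reduce D)

  reduceBox-value-realised : ∀ {C s} (view : BoxView C) (st : Status s) →
                             (∀ {v} → v ∈ witnesses st → ∃ λ y → valuation y ≡ v) →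
                             ∀ x {b} → evalP (valuation x) (reduceBox view s st) ≡ b →
                             ∃ λ y → evalP (valuation y) s ≡ b
  reduceBox-value-realised _ (valid s-valid)         _ x {true}  _  = x , s-valid _
  reduceBox-value-realised _ (valid _)               _ _ {false} ()
  reduceBox-value-realised _ (unsatisfiable s-unsat) _ x {false} _  = x , s-unsat _
  reduceBox-value-realised _ (unsatisfiable _)       _ _ {true}  ()
  reduceBox-value-realised _ (contingent v v⊭s _ _) realised _ {false} _ with realised (here refl)
  ... | y , refl = y , v⊭s
  reduceBox-value-realised _ (contingent _ _ w w⊨s) realised _ {true}  _ with realised (there (here refl))
  ... | y , refl = y , w⊨s

  □-value-realised : ∀ {C} → C ∈ boxed A → ∀ x {b} → holds x (□ C) ≡ b → ∃ λ y → holds y C ≡ b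
  □-value-realised {C} C∈A = reduceBox-value-realised (boxView C) (status (reduce C)) λ v∈ →
    world-of (there (∈-concatMap⁺ (λ C → witnesses (status (reduce C))) (lose C∈A v∈)))

  forces : World → Fm → Bool
  forces x (var n)  = valuation x (var n)
  forces x ⊥'       = false
  forces x (¬' D)   = not (forces x D)
  forces x (D ∧' E) = forces x D ∧ forces x E
  forces x (D ∨' E) = forces x D ∨ forces x E
  forces x (D ⇒ E)  = not (forces x D) ∨ forces x E
  forces x (□ C) with C ∈? boxed A
  ... | yes _ = holds x (□ C)
  ... | no  _ = forces x C

  -- Off the boxed subformulas of A the identity relation makes □C behave exactly like C.
  _↝[_]_ : World → Fm → World → Set
  x ↝[ C ] y with C ∈? boxed A
  ... | yes _ = holds x (□ C) ≡ true → forces y C ≡ true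
  ... | no  _ = x ≡ y

  forces-reduce : ∀ {D} → D ∈Sub A → ∀ x → forces x D ≡ holds x D
  forces-reduce {var n}  _ x = refl
  forces-reduce {⊥'}     _ x = refl
  forces-reduce {¬' D}   p x = cong not (forces-reduce (∈Sub-trans (in¬ here) p) x)
  forces-reduce {D ∧' E} p x =
    cong₂ _∧_ (forces-reduce (∈Sub-trans (in∧ˡ here) p) x) (forces-reduce (∈Sub-trans (in∧ʳ here) p) x)
  forces-reduce {D ∨' E} p x =
    cong₂ _∨_ (forces-reduce (∈Sub-trans (in∨ˡ here) p) x) (forces-reduce (∈Sub-trans (in∨ʳ here) p) x)
  forces-reduce {D ⇒ E}  p x = cong₂ (λ a b → not a ∨ b)
    (forces-reduce (∈Sub-trans (in⇒ˡ here) p) x) (forces-reduce (∈Sub-trans (in⇒ʳ here) p) x)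
  forces-reduce {□ C}    p x with C ∈? boxed A
  ... | yes _   = refl
  ... | no  C∉A = contradiction (∈-boxed⁺ p) C∉A

  forces-boxed : ∀ {C} → C ∈ boxed A → ∀ x → forces x C ≡ holds x C
  forces-boxed C∈A = forces-reduce (∈Sub-trans (in□ here) (∈-boxed⁻ A C∈A))

  forces-□⁻ : ∀ x C → forces x (□ C) ≡ true → ∀ y → x ↝[ C ] y → forces y C ≡ true
  forces-□⁻ x C with C ∈? boxed A
  ... | yes _ = λ x⊩□C y x↝y → x↝y x⊩□C
  ... | no  _ = λ { x⊩C y refl → x⊩C }

  forces-□⁺ : ∀ x C → (∀ y → x ↝[ C ] y → forces y C ≡ true) → forces x (□ C) ≡ true
  forces-□⁺ x C C-everywhere with C ∈? boxed A
  ... | no  _   = C-everywhere x refl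
  ... | yes C∈A with holds x (□ C) in x⊨□C
  ...   | true  = refl
  ...   | false with □-value-realised C∈A x x⊨□C
  ...     | y , y⊭C with trans (sym (C-everywhere y λ ())) (trans (forces-boxed C∈A y) y⊭C)
  ...       | ()

  frame : NFrame
  frame = record { W = World ; inhab = zero ; _≺[_]_ = _↝[_]_ }

  serial : Serial frame
  serial C x with C ∈? boxed A
  ... | no  _ = x , refl
  ... | yes C∈A with holds x (□ C) in x⊨□C
  ...   | false = x , λ ()
  ...   | true  = let (y , y⊨C) = □-value-realised C∈A x x⊨□C in
                  y , λ _ → trans (forces-boxed C∈A y) y⊨C

  transitive : Transitive frame
  transitive C x y z with □ C ∈? boxed A | C ∈? boxed A
  ... | no  _    | no  _   = trans
  ... | no  _    | yes _   = λ { refl y↝z → y↝z }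
  ... | yes □C∈A | no  C∉A =
    contradiction (∈-boxed⁺ (∈Sub-trans (in□ here) (∈-boxed⁻ A □C∈A))) C∉A
  ... | yes □C∈A | yes _   = λ x↝y y↝z x⊨□C →
    let x⊨□□C = evalP-reduceBox-nested (status (reduce (□ C))) x⊨□C in
    y↝z (trans (sym (forces-boxed □C∈A y)) (x↝y x⊨□□C))

  model : NModel frame
  model = record
    { _⊩_ = forces
    ; ⊩⊥  = λ _ → refl
    ; ⊩¬  = λ _ _ → refl
    ; ⊩∧  = λ _ _ _ → refl
    ; ⊩∨  = λ _ _ _ → refl
    ; ⊩⇒  = λ _ _ _ → refl
    ; ⊩□→ = forces-□⁻
    ; ⊩□← = forces-□⁺
    }

  finite : Finite frame
  finite = length valuations , ↔-refl

  not-valid : evalP v₀ (reduce A) ≡ false → ¬ ValidIn A frame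
  not-valid v₀⊭A A-valid
    with trans (sym (A-valid model zero)) (trans (forces-reduce here zero) v₀⊭A)
  ... | ()

Cond3⇒reduce-valid : ∀ A → Cond3 A → Tautology (reduce A)
Cond3⇒reduce-valid A cond3 with verdict (reduce A)
... | tautology reduce-A-valid = reduce-A-valid
... | refuted v₀ v₀⊭A = contradiction (cond3 frame finite transitive serial) (not-valid v₀⊭A)
  where open Countermodel A v₀

theorem3p14 : (A : Fm) →
    ((NR4⊢ A) ⇔ Cond2 A) × ((NR4⊢ A) ⇔ Cond3 A) × ((NR4⊢ A) ⇔ Cond4 A)
theorem3p14 A =
    mk⇔ ⊢⇒Cond2 (Cond3⇒⊢ ∘ Cond2⇒Cond3)
  , mk⇔ (Cond2⇒Cond3 ∘ ⊢⇒Cond2) Cond3⇒⊢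
  , mk⇔ (reduce-valid⇒Cond4 A ∘ Cond3⇒reduce-valid A ∘ Cond2⇒Cond3 ∘ ⊢⇒Cond2)
        (Cond3⇒⊢ ∘ Cond4⇒Cond3)
  where
  Cond2⇒Cond3 : Cond2 A → Cond3 A
  Cond2⇒Cond3 cond2 F _ = cond2 F

  Cond4⇒Cond3 : Cond4 A → Cond3 A
  Cond4⇒Cond3 cond4 F finite transitive serial =
    cond4 F finite (λ B _ → transitive B) (λ B _ → serial B)

  Cond3⇒⊢ : Cond3 A → NR4⊢ A
  Cond3⇒⊢ = ⊢-from-reduce A ∘ Cond3⇒reduce-valid A
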